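{- (a) Let $p\in\mathbb Z[x]$ be a nice antisymmetric polynomial of degree $d\ge5$ whose center $C$ is a root of $p$ of multiplicity one. Then $p''$ is not nice. (b) Let $p\in\mathbb Z[x]$ be a symmetric polynomial of degree $d\ge6$ all of whose roots lie in $\mathbb Z$, whose center $C$ is not a root of $p$, and whose derivative $p'$ is nice. Then $p'''$ is not nice.
   Context: A polynomial $f\in\mathbb Z[x]$ of degree $n\ge2$ is nice if $f$ and its derivative $f'$ both factor as products of linear factors over $\mathbb Z$ (i.e. $f=c\prod(x-x_i)$, $f'=c'\prod(x-x'_j)$ with all $c,c',x_i,x'_j\in\mathbb Z$). A non-constant $p\in\mathbb Z[x]$ is symmetric (resp. antisymmetric) if there is $C\in\mathbb Z$, its center, with $p(C-a)=p(C+a)$ (resp. $p(C-a)=-p(C+a)$) for all $a\in\mathbb Z$. -}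

module Defs where

open import Data.Nat using (ℕ; zero; suc; _≤_; _<_)
open import Data.Integer using (ℤ; +_; _+_; _-_; _*_; -_)
open import Data.List using (List; []; _∷_)
open import Data.Product using (Σ; _×_; ∃)
open import Relation.Binary.PropositionalEquality using (_≡_; _≢_)

-- Polynomials in ℤ[x] as little-endian coefficient lists:
-- a₀ ∷ a₁ ∷ … represents a₀ + a₁ x + …  (trailing zeros allowed).
Poly : Set
Poly = List ℤ

coeff : Poly → ℕ → ℤ
coeff []      n       = + 0
coeff (a ∷ p) zero    = a
coeff (a ∷ p) (suc n) = coeff p n

_≈ₚ_ : Poly → Poly → Set
p ≈ₚ q = ∀ n → coeff p n ≡ coeff q n

eval : Poly → ℤ → ℤ
eval []      x = + 0
eval (a ∷ p) x = a + x * eval p x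

addP : Poly → Poly → Poly
addP []      q       = q
addP (a ∷ p) []      = a ∷ p
addP (a ∷ p) (b ∷ q) = (a + b) ∷ addP p q

scaleP : ℤ → Poly → Poly
scaleP c []      = []
scaleP c (a ∷ p) = (c * a) ∷ scaleP c p

mulP : Poly → Poly → Poly
mulP []      q = []
mulP (a ∷ p) q = addP (scaleP a q) (+ 0 ∷ mulP p q)

derivAux : ℕ → Poly → Poly
derivAux k []      = []
derivAux k (b ∷ r) = (+ k * b) ∷ derivAux (suc k) r

deriv : Poly → Poly
deriv []      = []
deriv (a ∷ p) = derivAux 1 p

lin : ℤ → Poly
lin c = (- c) ∷ + 1 ∷ []

prodLin : List ℤ → Poly
prodLin []       = + 1 ∷ []
prodLin (c ∷ cs) = mulP (lin c) (prodLin cs)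

HasDegree : Poly → ℕ → Set
HasDegree p n = (coeff p n ≢ + 0) × (∀ m → n < m → coeff p m ≡ + 0)

NonConstant : Poly → Set
NonConstant p = ∃ λ n → (1 ≤ n) × HasDegree p n

SplitsOverℤ : Poly → Set
SplitsOverℤ p = Σ ℤ λ c → Σ (List ℤ) λ xs → p ≈ₚ scaleP c (prodLin xs)

Nice : Poly → Set
Nice f = (∃ λ n → (2 ≤ n) × HasDegree f n) × SplitsOverℤ f × SplitsOverℤ (deriv f)

SymmetricWithCenter : Poly → ℤ → Set
SymmetricWithCenter p C = NonConstant p × (∀ a → eval p (C - a) ≡ eval p (C + a))

AntisymmetricWithCenter : Poly → ℤ → Set
AntisymmetricWithCenter p C = NonConstant p × (∀ a → eval p (C - a) ≡ - eval p (C + a))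

SimpleRoot : Poly → ℤ → Set
SimpleRoot p C = Σ Poly λ q → (p ≈ₚ mulP (lin C) q) × (eval q C ≢ + 0)

-- Centre everything at C, so that f becomes an odd function F with F′(0) ≠ 0. If F and its even
-- derivative F′ split over ℤ, the roots of F are 0 and pairs ±b, those of F′ are pairs ±e, with as
-- many pairs in each; comparing F′(0) = c·∏(−b²) with F′(0) = n·c·∏(−e²), n = deg F, shows that n
-- is a perfect square. Moreover F‴(0) ≠ 0, because all terms of (∏(a² − e²))″ at 0 have the same
-- sign, so the argument applies again to the odd F″ of degree n − 2. But n and n − 2 cannot both be
-- squares. In case (b) the argument applies to F = p′, for which F′(0) = p″(C) ≠ 0 by the same sign
-- argument.

module Submission where

open import Defs
open import Data.Nat using (ℕ; _≤_)
open import Data.Integer using (ℤ; +_)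
open import Data.Product using (_×_)
open import Relation.Nullary using (¬_)
open import Relation.Binary.PropositionalEquality using (_≢_)

open import Data.Nat as ℕ using (zero; suc; s≤s)
import Data.Nat.Properties as ℕₚ
import Data.Nat.Divisibility as ℕᵈ
open import Data.Nat.DivMod using (_/_; m/n*n≡m)
open import Data.Nat.GCD using (gcd; gcd[m,n]∣m; gcd[m,n]∣n; gcd[m,n]≢0)
open import Data.Nat.Coprimality using (coprime-/gcd; coprime-divisor)
import Data.Nat.Tactic.RingSolver as ℕ-Solver
open import Data.Integer as ℤ using (-[1+_]; _+_; _-_; _*_; -_; _^_; ∣_∣; 0ℤ; 1ℤ; -1ℤ)
import Data.Integer.Properties as ℤₚ
open import Data.Integer.Divisibility.Signed
open import Data.Integer.Tactic.RingSolver using (solve-∀)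
open import Data.List using (List; []; _∷_; length; map; foldr)
open import Data.List.Properties using (length-map; length-removeAt′)
open import Data.List.Membership.Propositional using (_∈_; _∉_)
open import Data.List.Relation.Unary.Any using (here; there; index; _─_)
open import Data.Product using (Σ; ∃; _,_; proj₁; proj₂) renaming (map to Σ-map)
open import Data.Sum using (_⊎_; inj₁; inj₂; [_,_]′)
open import Data.Empty using (⊥)
open import Function using (_∘_; id)
open import Relation.Nullary using (yes; no; contradiction)
open import Relation.Binary.Definitions using (Tri; tri<; tri≈; tri>)
open import Relation.Binary.PropositionalEquality
  using (_≡_; refl; sym; trans; cong; cong₂; subst; subst₂; module ≡-Reasoning)

private
  variable
    F F′ F″ G G′ : ℤ → ℤ

*-≢0 : ∀ {i j} → i ≢ 0ℤ → j ≢ 0ℤ → i * j ≢ 0ℤ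
*-≢0 {i} i≢0 j≢0 ij≡0 = [ i≢0 , j≢0 ]′ (ℤₚ.i*j≡0⇒i≡0∨j≡0 i ij≡0)

x≢y⇒x-y≢0 : ∀ {x y} → x ≢ y → x - y ≢ 0ℤ
x≢y⇒x-y≢0 {x} {y} x≢y = x≢y ∘ ℤₚ.i-j≡0⇒i≡j x y

*≡0⇒≡0ʳ : ∀ {i j} → i ≢ 0ℤ → i * j ≡ 0ℤ → j ≡ 0ℤ
*≡0⇒≡0ʳ {i} i≢0 ij≡0 = [ (λ i≡0 → contradiction i≡0 i≢0) , id ]′ (ℤₚ.i*j≡0⇒i≡0∨j≡0 i ij≡0)

neg-≢0 : ∀ {x} → x ≢ 0ℤ → - x ≢ 0ℤ
neg-≢0 {x} x≢0 -x≡0 = x≢0 (trans (sym (ℤₚ.neg-involutive x)) (cong -_ -x≡0))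

self-neg⇒≡0 : ∀ {x} → x ≡ - x → x ≡ 0ℤ
self-neg⇒≡0 {x} x≡-x = *≡0⇒≡0ʳ {+ 2} (λ ()) (trans (doubled x) (trans (cong (λ y → x + y) x≡-x) (ℤₚ.+-inverseʳ x)))
  where
  doubled : ∀ x → + 2 * x ≡ x + x
  doubled = solve-∀

∣-all⇒≡0 : ∀ {x} → (∀ t → t ≢ 0ℤ → t ∣ x) → x ≡ 0ℤ
∣-all⇒≡0 {x} h = ℤₚ.∣i∣≡0⇒i≡0 (divisible-by-suc (∣⇒∣ᵤ (h (+ suc ∣ x ∣) λ ())))
  where
  divisible-by-suc : ∀ {n} → suc n ℕᵈ.∣ n → n ≡ 0
  divisible-by-suc {zero}  _ = refl
  divisible-by-suc {suc n} d = contradiction d (ℕᵈ.>⇒∤ ℕₚ.≤-refl)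

∣-all⇒≡ : ∀ {x y} → (∀ t → t ≢ 0ℤ → t ∣ x - y) → x ≡ y
∣-all⇒≡ {x} {y} h = ℤₚ.i-j≡0⇒i≡j x y (∣-all⇒≡0 h)

-- Derivatives without limits: for a polynomial F, F′(z) is the unique d with t² ∣ F (z + t) − F z − t·d
-- for all t.
HasDerivAt : (ℤ → ℤ) → ℤ → ℤ → Set
HasDerivAt F z d = ∀ t → t * t ∣ F (z + t) - F z - t * d

record Derivative (F F′ : ℤ → ℤ) : Set where
  constructor derivative
  field hasDerivAt : ∀ z → HasDerivAt F z (F′ z)
open Derivative

Differentiable : (ℤ → ℤ) → Set
Differentiable F = Σ (ℤ → ℤ) (Derivative F)

HasDerivAt-unique : ∀ {z d e} → HasDerivAt F z d → HasDerivAt F z e → d ≡ e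
HasDerivAt-unique {F} {z} {d} {e} Fd Fe = ∣-all⇒≡ λ t t≢0 →
  let instance _ = ℤ.≢-nonZero t≢0
  in *-cancelˡ-∣ t (subst (t * t ∣_) (difference (F (z + t)) (F z) t d e) (∣m∣n⇒∣m-n (Fe t) (Fd t)))
  where
  difference : ∀ A B t d e → A - B - t * e - (A - B - t * d) ≡ t * (d - e)
  difference = solve-∀

Derivative-cong : (∀ a → F a ≡ G a) → (∀ a → F′ a ≡ G′ a) → Derivative F F′ → Derivative G G′
Derivative-cong F≡G F′≡G′ (derivative dF) = derivative λ z t →
  subst (t * t ∣_) (cong₂ _-_ (cong₂ _-_ (F≡G (z + t)) (F≡G z)) (cong (t *_) (F′≡G′ z))) (dF z t)

Derivative-unique : (∀ a → F a ≡ G a) → Derivative F F′ → Derivative G G′ → ∀ a → F′ a ≡ G′ a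
Derivative-unique {F} {G} F≡G dF dG a =
  HasDerivAt-unique {G} (hasDerivAt (Derivative-cong F≡G (λ _ → refl) dF) a) (hasDerivAt dG a)

Derivative-const : ∀ {c} → Derivative (λ _ → c) (λ _ → 0ℤ)
Derivative-const {c} = derivative λ z t → divides 0ℤ (vanishes c t)
  where
  vanishes : ∀ c t → c - c - t * 0ℤ ≡ 0ℤ
  vanishes = solve-∀

Derivative-id : Derivative (λ a → a) (λ _ → 1ℤ)
Derivative-id = derivative λ z t → divides 0ℤ (vanishes z t)
  where
  vanishes : ∀ z t → z + t - z - t * 1ℤ ≡ 0ℤ
  vanishes = solve-∀

Derivative-+ : Derivative F F′ → Derivative G G′ → Derivative (λ a → F a + G a) (λ a → F′ a + G′ a)
Derivative-+ {F} {F′} {G} {G′} (derivative dF) (derivative dG) = derivative λ z t →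
  subst (t * t ∣_) (sum-rule (F (z + t)) (F z) (F′ z) (G (z + t)) (G z) (G′ z) t)
    (∣m∣n⇒∣m+n (dF z t) (dG z t))
  where
  sum-rule : ∀ A a a′ B b b′ t → (A - a - t * a′) + (B - b - t * b′) ≡ A + B - (a + b) - t * (a′ + b′)
  sum-rule = solve-∀

Derivative-* : Derivative F F′ → Derivative G G′ → Derivative (λ a → F a * G a) (λ a → F′ a * G a + F a * G′ a)
Derivative-* {F} {F′} {G} {G′} (derivative dF) (derivative dG) = derivative λ z t →
  subst (t * t ∣_) (product-rule (F (z + t)) (F z) (F′ z) (G (z + t)) (G z) (G′ z) t)
    (∣m∣n⇒∣m+n (∣m∣n⇒∣m+n (∣n⇒∣m*n (G z + t * G′ z) (dF z t)) (∣n⇒∣m*n (F (z + t)) (dG z t)))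
      (∣m⇒∣m*n (F′ z * G′ z) ∣-refl))
  where
  product-rule : ∀ A a a′ B b b′ t →
    (b + t * b′) * (A - a - t * a′) + A * (B - b - t * b′) + t * t * (a′ * b′) ≡ A * B - a * b - t * (a′ * b + a * b′)
  product-rule = solve-∀

Derivative-scale : ∀ c → Derivative F F′ → Derivative (λ a → c * F a) (λ a → c * F′ a)
Derivative-scale {F′ = F′} c dF =
  Derivative-cong (λ _ → refl) (λ a → ℤₚ.+-identityˡ (c * F′ a)) (Derivative-* (Derivative-const {c}) dF)

Derivative-neg : Derivative F F′ → Derivative (λ a → - F a) (λ a → - F′ a)
Derivative-neg {F} {F′} dF =
  Derivative-cong (λ a → ℤₚ.-1*i≡-i (F a)) (λ a → ℤₚ.-1*i≡-i (F′ a)) (Derivative-scale -1ℤ dF)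

Derivative-translate : ∀ C → Derivative F F′ → Derivative (λ a → F (C + a)) (λ a → F′ (C + a))
Derivative-translate {F} {F′} C (derivative dF) = derivative λ z t →
  subst (λ x → t * t ∣ F x - F (C + z) - t * F′ (C + z)) (ℤₚ.+-assoc C z t) (dF (C + z) t)

Derivative-reflect : Derivative F F′ → Derivative (λ a → F (- a)) (λ a → - F′ (- a))
Derivative-reflect {F} {F′} (derivative dF) = derivative λ z t →
  subst₂ _∣_ (neg-square t) (cong₂ (λ x y → F x - F (- z) - y) (sym (ℤₚ.neg-distrib-+ z t)) (swap-sign t (F′ (- z))))
    (dF (- z) (- t))
  where
  neg-square : ∀ t → - t * - t ≡ t * t
  neg-square = solve-∀
  swap-sign : ∀ t d → - t * d ≡ t * - d
  swap-sign = solve-∀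

Even Odd : (ℤ → ℤ) → Set
Even F = ∀ a → F (- a) ≡ F a
Odd  F = ∀ a → F (- a) ≡ - F a

Derivative-odd⇒even : Derivative F F′ → Odd F → Even F′
Derivative-odd⇒even dF odd a =
  ℤₚ.neg-injective (Derivative-unique odd (Derivative-reflect dF) (Derivative-neg dF) a)

Derivative-even⇒odd : Derivative F F′ → Even F → Odd F′
Derivative-even⇒odd {F′ = F′} dF even a = begin
  F′ (- a)      ≡⟨ ℤₚ.neg-involutive (F′ (- a)) ⟨
  - - F′ (- a)  ≡⟨ cong -_ (Derivative-unique even (Derivative-reflect dF) dF a) ⟩
  - F′ a        ∎
  where open ≡-Reasoning

Derivative⇒∣-differences : Derivative F F′ → ∀ a b → a - b ∣ F a - F b
Derivative⇒∣-differences {F} {F′} (derivative dF) a b =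
  subst (a - b ∣_) (trans (telescope (F (b + (a - b))) (F b) (a - b) (F′ b)) (cong (λ x → F x - F b) (b+[a-b]≡a a b)))
    (∣m∣n⇒∣m+n (∣-trans (∣m⇒∣m*n (a - b) ∣-refl) (dF b (a - b))) (∣n⇒∣m*n (F′ b) ∣-refl))
  where
  telescope : ∀ A B t d → A - B - t * d + d * t ≡ A - B
  telescope = solve-∀
  b+[a-b]≡a : ∀ a b → b + (a - b) ≡ a
  b+[a-b]≡a = solve-∀

Derivative-x*-at-0 : ∀ c {R R′} → Derivative R R′ → (∀ a → F a ≡ c * (a * R a)) → Derivative F F′ → F′ 0ℤ ≡ c * R 0ℤ
Derivative-x*-at-0 c {R} {R′} dR F≡ dF =
  trans (Derivative-unique F≡ dF (Derivative-scale c (Derivative-* Derivative-id dR)) 0ℤ) (simplify c (R 0ℤ) (R′ 0ℤ))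
  where
  simplify : ∀ c r r′ → c * (1ℤ * r + 0ℤ * r′) ≡ c * r
  simplify = solve-∀

pigeonhole : ∀ {A : Set} {u w x y z : A} → (x ≡ u ⊎ x ≡ w) → (y ≡ u ⊎ y ≡ w) → (z ≡ u ⊎ z ≡ w) →
  x ≡ y ⊎ x ≡ z ⊎ y ≡ z
pigeonhole (inj₁ x≡u) (inj₁ y≡u) _          = inj₁ (trans x≡u (sym y≡u))
pigeonhole (inj₂ x≡w) (inj₂ y≡w) _          = inj₁ (trans x≡w (sym y≡w))
pigeonhole (inj₁ x≡u) (inj₂ _)   (inj₁ z≡u) = inj₂ (inj₁ (trans x≡u (sym z≡u)))
pigeonhole (inj₁ _)   (inj₂ y≡w) (inj₂ z≡w) = inj₂ (inj₂ (trans y≡w (sym z≡w)))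
pigeonhole (inj₂ x≡w) (inj₁ _)   (inj₂ z≡w) = inj₂ (inj₁ (trans x≡w (sym z≡w)))
pigeonhole (inj₂ _)   (inj₁ y≡u) (inj₁ z≡u) = inj₂ (inj₂ (trans y≡u (sym z≡u)))

-- Of the three points a + t, a + 2t, a + 3t one avoids u and w, so t ∣ F a for every t ≠ 0.
vanishes-off-two : ∀ u w → Derivative F F′ → (∀ b → b ≢ u → b ≢ w → F b ≡ 0ℤ) → ∀ a → F a ≡ 0ℤ
vanishes-off-two {F} u w dF off a = ∣-all⇒≡0 divides-Fa
  where
  point : ℤ → ℕ → ℤ
  point t j = a + + j * t

  point-injective : ∀ {t i j} → t ≢ 0ℤ → point t i ≡ point t j → i ≡ j
  point-injective {t} {i} {j} t≢0 eq = ℤₚ.+-injective (ℤₚ.*-cancelʳ-≡ (+ i) (+ j) t {{ℤ.≢-nonZero t≢0}}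
    (trans (sym (cancel a (+ i * t))) (trans (cong (_- a) eq) (cancel a (+ j * t)))))
    where
    cancel : ∀ a x → a + x - a ≡ x
    cancel = solve-∀

  divides-off-root : ∀ t j → F (point t j) ≡ 0ℤ → t ∣ F a
  divides-off-root t j F≡0 = begin
    t                   ∣⟨ divides (- + j) (offset a (+ j) t) ⟩
    a - point t j       ∣⟨ Derivative⇒∣-differences dF a (point t j) ⟩
    F a - F (point t j) ≡⟨ cong (λ x → F a - x) F≡0 ⟩
    F a - 0ℤ            ≡⟨ ℤₚ.+-identityʳ (F a) ⟩
    F a                 ∎
    where
    open ∣-Reasoning
    offset : ∀ a j t → a - (a + j * t) ≡ - j * t
    offset = solve-∀

  probe : ∀ t j → (point t j ≡ u ⊎ point t j ≡ w) ⊎ t ∣ F a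
  probe t j with point t j ℤ.≟ u | point t j ℤ.≟ w
  ... | yes p≡u | _       = inj₁ (inj₁ p≡u)
  ... | no _    | yes p≡w = inj₁ (inj₂ p≡w)
  ... | no p≢u  | no p≢w  = inj₂ (divides-off-root t j (off _ p≢u p≢w))

  divides-Fa : ∀ t → t ≢ 0ℤ → t ∣ F a
  divides-Fa t t≢0 with probe t 1 | probe t 2 | probe t 3
  ... | inj₂ d  | _       | _       = d
  ... | inj₁ _  | inj₂ d  | _       = d
  ... | inj₁ _  | inj₁ _  | inj₂ d  = d
  ... | inj₁ h₁ | inj₁ h₂ | inj₁ h₃ with pigeonhole h₁ h₂ h₃
  ...   | inj₁ p₁≡p₂        = contradiction (point-injective {i = 1} {2} t≢0 p₁≡p₂) λ ()
  ...   | inj₂ (inj₁ p₁≡p₃) = contradiction (point-injective {i = 1} {3} t≢0 p₁≡p₃) λ ()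
  ...   | inj₂ (inj₂ p₂≡p₃) = contradiction (point-injective {i = 2} {3} t≢0 p₂≡p₃) λ ()

-- Polynomials

eval-addP : ∀ p q y → eval (addP p q) y ≡ eval p y + eval q y
eval-addP []      q       y = sym (ℤₚ.+-identityˡ _)
eval-addP (a ∷ p) []      y = sym (ℤₚ.+-identityʳ _)
eval-addP (a ∷ p) (b ∷ q) y rewrite eval-addP p q y = regroup a b y (eval p y) (eval q y)
  where
  regroup : ∀ a b y P Q → a + b + y * (P + Q) ≡ a + y * P + (b + y * Q)
  regroup = solve-∀

eval-scaleP : ∀ c p y → eval (scaleP c p) y ≡ c * eval p y
eval-scaleP c []      y = sym (ℤₚ.*-zeroʳ c)
eval-scaleP c (a ∷ p) y rewrite eval-scaleP c p y = regroup c a y (eval p y)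
  where
  regroup : ∀ c a y P → c * a + y * (c * P) ≡ c * (a + y * P)
  regroup = solve-∀

eval-mulP : ∀ p q y → eval (mulP p q) y ≡ eval p y * eval q y
eval-mulP []      q y = refl
eval-mulP (a ∷ p) q y
  rewrite eval-addP (scaleP a q) (0ℤ ∷ mulP p q) y | eval-scaleP a q y | eval-mulP p q y
  = regroup a y (eval p y) (eval q y)
  where
  regroup : ∀ a y P Q → a * Q + (0ℤ + y * (P * Q)) ≡ (a + y * P) * Q
  regroup = solve-∀

eval-lin : ∀ c y → eval (lin c) y ≡ y - c
eval-lin c y = expand c y
  where
  expand : ∀ c y → - c + y * (1ℤ + y * 0ℤ) ≡ y - c
  expand = solve-∀

∏lin : List ℤ → ℤ → ℤ
∏lin []       a = 1ℤ
∏lin (x ∷ xs) a = (a - x) * ∏lin xs a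

eval-prodLin : ∀ xs y → eval (prodLin xs) y ≡ ∏lin xs y
eval-prodLin []       y = constant y
  where
  constant : ∀ y → 1ℤ + y * 0ℤ ≡ 1ℤ
  constant = solve-∀
eval-prodLin (x ∷ xs) y rewrite eval-mulP (lin x) (prodLin xs) y | eval-lin x y | eval-prodLin xs y = refl

eval-null : ∀ p → (∀ n → coeff p n ≡ 0ℤ) → ∀ y → eval p y ≡ 0ℤ
eval-null []      _ y = refl
eval-null (a ∷ p) h y =
  trans (cong₂ (λ u v → u + y * v) (h 0) (eval-null p (h ∘ suc) y)) (trans (ℤₚ.+-identityˡ _) (ℤₚ.*-zeroʳ y))

eval-≈ₚ : ∀ p q → p ≈ₚ q → ∀ y → eval p y ≡ eval q y
eval-≈ₚ []      q       p≈q y = sym (eval-null q (sym ∘ p≈q) y)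
eval-≈ₚ (a ∷ p) []      p≈q y = eval-null (a ∷ p) p≈q y
eval-≈ₚ (a ∷ p) (b ∷ q) p≈q y = cong₂ (λ u v → u + y * v) (p≈q 0) (eval-≈ₚ p q (p≈q ∘ suc) y)

centred : Poly → ℤ → ℤ → ℤ
centred f C a = eval f (C + a)

centred-0 : ∀ f C → centred f C 0ℤ ≡ eval f C
centred-0 f C = cong (eval f) (ℤₚ.+-identityʳ C)

∏lin-translate : ∀ xs C a → ∏lin xs (C + a) ≡ ∏lin (map (_- C) xs) a
∏lin-translate []       C a = refl
∏lin-translate (x ∷ xs) C a = cong₂ _*_ (shift x C a) (∏lin-translate xs C a)
  where
  shift : ∀ x C a → C + a - x ≡ a - (x - C)
  shift = solve-∀

centred-split : ∀ {f c xs} C → f ≈ₚ scaleP c (prodLin xs) → ∀ a → centred f C a ≡ c * ∏lin (map (_- C) xs) a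
centred-split {f} {c} {xs} C f≈ a = begin
  eval f (C + a)                        ≡⟨ eval-≈ₚ f (scaleP c (prodLin xs)) f≈ (C + a) ⟩
  eval (scaleP c (prodLin xs)) (C + a)  ≡⟨ eval-scaleP c (prodLin xs) (C + a) ⟩
  c * eval (prodLin xs) (C + a)         ≡⟨ cong (c *_) (eval-prodLin xs (C + a)) ⟩
  c * ∏lin xs (C + a)                   ≡⟨ cong (c *_) (∏lin-translate xs C a) ⟩
  c * ∏lin (map (_- C) xs) a            ∎
  where open ≡-Reasoning

coeff-addP : ∀ p q n → coeff (addP p q) n ≡ coeff p n + coeff q n
coeff-addP []      q       n       = sym (ℤₚ.+-identityˡ _)
coeff-addP (a ∷ p) []      n       = sym (ℤₚ.+-identityʳ _)
coeff-addP (a ∷ p) (b ∷ q) zero    = refl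
coeff-addP (a ∷ p) (b ∷ q) (suc n) = coeff-addP p q n

coeff-scaleP : ∀ c p n → coeff (scaleP c p) n ≡ c * coeff p n
coeff-scaleP c []      n       = sym (ℤₚ.*-zeroʳ c)
coeff-scaleP c (a ∷ p) zero    = refl
coeff-scaleP c (a ∷ p) (suc n) = coeff-scaleP c p n

coeff-lin*-suc : ∀ c g n → coeff (mulP (lin c) g) (suc n) ≡ - c * coeff g (suc n) + coeff g n
coeff-lin*-suc c g n = begin
  coeff (mulP (lin c) g) (suc n)                                ≡⟨ coeff-addP (scaleP (- c) g) _ (suc n) ⟩
  coeff (scaleP (- c) g) (suc n) + coeff (mulP (1ℤ ∷ []) g) n   ≡⟨ cong₂ _+_ (coeff-scaleP (- c) g (suc n)) (coeff-one* n) ⟩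
  - c * coeff g (suc n) + coeff g n                             ∎
  where
  open ≡-Reasoning
  coeff-one* : ∀ n → coeff (mulP (1ℤ ∷ []) g) n ≡ coeff g n
  coeff-one* n = begin
    coeff (mulP (1ℤ ∷ []) g) n                 ≡⟨ coeff-addP (scaleP 1ℤ g) (0ℤ ∷ []) n ⟩
    coeff (scaleP 1ℤ g) n + coeff (0ℤ ∷ []) n  ≡⟨ cong₂ _+_ (coeff-scaleP 1ℤ g n) (coeff-[0] n) ⟩
    1ℤ * coeff g n + 0ℤ                        ≡⟨ ℤₚ.+-identityʳ (1ℤ * coeff g n) ⟩
    1ℤ * coeff g n                             ≡⟨ ℤₚ.*-identityˡ (coeff g n) ⟩
    coeff g n                                  ∎
    where
    coeff-[0] : ∀ n → coeff (0ℤ ∷ []) n ≡ 0ℤ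
    coeff-[0] zero    = refl
    coeff-[0] (suc n) = refl

coeff-prodLin-> : ∀ xs n → length xs ℕ.< n → coeff (prodLin xs) n ≡ 0ℤ
coeff-prodLin-> []       (suc n) _         = refl
coeff-prodLin-> (x ∷ xs) (suc n) (s≤s |xs|<n)
  rewrite coeff-lin*-suc x (prodLin xs) n | coeff-prodLin-> xs (suc n) (ℕₚ.m<n⇒m<1+n |xs|<n)
        | coeff-prodLin-> xs n |xs|<n | ℤₚ.*-zeroʳ (- x) = refl

coeff-prodLin-length : ∀ xs → coeff (prodLin xs) (length xs) ≡ 1ℤ
coeff-prodLin-length []       = refl
coeff-prodLin-length (x ∷ xs)
  rewrite coeff-lin*-suc x (prodLin xs) (length xs) | coeff-prodLin-> xs (suc (length xs)) ℕₚ.≤-refl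
        | coeff-prodLin-length xs | ℤₚ.*-zeroʳ (- x) = refl

split-degree : ∀ {f n c xs} → HasDegree f n → f ≈ₚ scaleP c (prodLin xs) → n ≡ length xs × c ≡ coeff f n
split-degree {f} {n} {c} {xs} (fn≢0 , f>n≡0) f≈ = by-cases (ℕₚ.<-cmp n (length xs))
  where
  open ≡-Reasoning
  coeff-f : ∀ m → coeff f m ≡ c * coeff (prodLin xs) m
  coeff-f m = trans (f≈ m) (coeff-scaleP c (prodLin xs) m)
  by-cases : Tri (n ℕ.< length xs) (n ≡ length xs) (length xs ℕ.< n) → n ≡ length xs × c ≡ coeff f n
  by-cases (tri< n<|xs| _ _) = contradiction fn≡0 fn≢0
    where
    c≡0 : c ≡ 0ℤ
    c≡0 = begin
      c                                   ≡⟨ ℤₚ.*-identityʳ c ⟨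
      c * 1ℤ                              ≡⟨ cong (c *_) (coeff-prodLin-length xs) ⟨
      c * coeff (prodLin xs) (length xs)  ≡⟨ coeff-f (length xs) ⟨
      coeff f (length xs)                 ≡⟨ f>n≡0 (length xs) n<|xs| ⟩
      0ℤ                                  ∎
    fn≡0 : coeff f n ≡ 0ℤ
    fn≡0 = trans (coeff-f n) (cong (_* coeff (prodLin xs) n) c≡0)
  by-cases (tri≈ _ refl _) = refl , sym (begin
    coeff f n                  ≡⟨ coeff-f n ⟩
    c * coeff (prodLin xs) n   ≡⟨ cong (c *_) (coeff-prodLin-length xs) ⟩
    c * 1ℤ                     ≡⟨ ℤₚ.*-identityʳ c ⟩
    c                          ∎)
  by-cases (tri> _ _ |xs|<n) = contradiction fn≡0 fn≢0
    where
    fn≡0 : coeff f n ≡ 0ℤ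
    fn≡0 = begin
      coeff f n                 ≡⟨ coeff-f n ⟩
      c * coeff (prodLin xs) n  ≡⟨ cong (c *_) (coeff-prodLin-> xs n |xs|<n) ⟩
      c * 0ℤ                    ≡⟨ ℤₚ.*-zeroʳ c ⟩
      0ℤ                        ∎

coeff-derivAux : ∀ j r k → coeff (derivAux j r) k ≡ + (j ℕ.+ k) * coeff r k
coeff-derivAux j []      k       = sym (ℤₚ.*-zeroʳ (+ (j ℕ.+ k)))
coeff-derivAux j (b ∷ r) zero    rewrite ℕₚ.+-identityʳ j = refl
coeff-derivAux j (b ∷ r) (suc k) rewrite coeff-derivAux (suc j) r k | ℕₚ.+-suc j k = refl

coeff-deriv : ∀ f k → coeff (deriv f) k ≡ + suc k * coeff f (suc k)
coeff-deriv []      k = sym (ℤₚ.*-zeroʳ (+ suc k))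
coeff-deriv (a ∷ r) k = coeff-derivAux 1 r k

HasDegree-deriv : ∀ f {n} → HasDegree f (suc n) → HasDegree (deriv f) n
HasDegree-deriv f {n} (fn≢0 , f>n≡0) =
  (λ f′n≡0 → *-≢0 {+ suc n} (λ ()) fn≢0 (trans (sym (coeff-deriv f n)) f′n≡0)) ,
  λ m n<m → trans (coeff-deriv f m) (trans (cong (+ suc m *_) (f>n≡0 (suc m) (s≤s n<m))) (ℤₚ.*-zeroʳ (+ suc m)))

eval-derivAux-suc : ∀ k r y → eval (derivAux (suc k) r) y ≡ eval r y + eval (derivAux k r) y
eval-derivAux-suc k []      y = refl
eval-derivAux-suc k (b ∷ r) y rewrite eval-derivAux-suc (suc k) r y | ℤₚ.pos-+ 1 k =
  regroup (+ k) b y (eval r y) (eval (derivAux (suc k) r) y)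
  where
  regroup : ∀ k b y R D → (1ℤ + k) * b + y * (R + D) ≡ b + y * R + (k * b + y * D)
  regroup = solve-∀

eval-derivAux-zero : ∀ r y → eval (derivAux 0 r) y ≡ y * eval (deriv r) y
eval-derivAux-zero []      y = sym (ℤₚ.*-zeroʳ y)
eval-derivAux-zero (b ∷ r) y = ℤₚ.+-identityˡ _

eval-derivative : ∀ f → Derivative (eval f) (eval (deriv f))
eval-derivative []      = Derivative-const
eval-derivative (a ∷ r) =
  Derivative-cong (λ _ → refl) product-rule
    (Derivative-+ (Derivative-const {a}) (Derivative-* Derivative-id (eval-derivative r)))
  where
  simplify : ∀ R R′ → 0ℤ + (1ℤ * R + R′) ≡ R + R′
  simplify = solve-∀
  product-rule : ∀ y → 0ℤ + (1ℤ * eval r y + y * eval (deriv r) y) ≡ eval (derivAux 1 r) y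
  product-rule y = begin
    0ℤ + (1ℤ * eval r y + y * eval (deriv r) y)  ≡⟨ simplify (eval r y) (y * eval (deriv r) y) ⟩
    eval r y + y * eval (deriv r) y              ≡⟨ cong (λ d → eval r y + d) (eval-derivAux-zero r y) ⟨
    eval r y + eval (derivAux 0 r) y             ≡⟨ eval-derivAux-suc 0 r y ⟨
    eval (derivAux 1 r) y                        ∎
    where open ≡-Reasoning

centred-derivative : ∀ f C → Derivative (centred f C) (centred (deriv f) C)
centred-derivative f C = Derivative-translate C (eval-derivative f)

∈-─⁻ : ∀ {A : Set} {x u : A} {xs} (u∈xs : u ∈ xs) → x ∈ (xs ─ u∈xs) → x ∈ xs
∈-─⁻ (here _)    x∈       = there x∈
∈-─⁻ (there u∈)  (here e) = here e
∈-─⁻ (there u∈)  (there x∈) = there (∈-─⁻ u∈ x∈)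

∏lin-─ : ∀ {u xs} (u∈xs : u ∈ xs) a → ∏lin xs a ≡ (a - u) * ∏lin (xs ─ u∈xs) a
∏lin-─ (here refl)                   a = refl
∏lin-─ {u} (there {x} {xs} u∈xs) a = begin
  (a - x) * ∏lin xs a                        ≡⟨ cong ((a - x) *_) (∏lin-─ u∈xs a) ⟩
  (a - x) * ((a - u) * ∏lin (xs ─ u∈xs) a)   ≡⟨ swap (a - x) (a - u) _ ⟩
  (a - u) * ((a - x) * ∏lin (xs ─ u∈xs) a)   ∎
  where
  open ≡-Reasoning
  swap : ∀ p q r → p * (q * r) ≡ q * (p * r)
  swap = solve-∀

∈⇒∏lin≡0 : ∀ {u xs} → u ∈ xs → ∏lin xs u ≡ 0ℤ
∈⇒∏lin≡0 {u} {xs} u∈xs = trans (∏lin-─ u∈xs u) (cong (_* ∏lin (xs ─ u∈xs) u) (ℤₚ.+-inverseʳ u))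

∏lin≡0⇒∈ : ∀ xs {a} → ∏lin xs a ≡ 0ℤ → a ∈ xs
∏lin≡0⇒∈ (x ∷ xs) {a} e with ℤₚ.i*j≡0⇒i≡0∨j≡0 (a - x) e
... | inj₁ a-x≡0 = here (ℤₚ.i-j≡0⇒i≡j a x a-x≡0)
... | inj₂ rest≡0 = there (∏lin≡0⇒∈ xs rest≡0)

∏lin-differentiable : ∀ xs → Differentiable (∏lin xs)
∏lin-differentiable []       = _ , Derivative-const
∏lin-differentiable (x ∷ xs) =
  _ , Derivative-* (Derivative-+ Derivative-id Derivative-const) (proj₂ (∏lin-differentiable xs))

Split : ℕ → ℤ → (ℤ → ℤ) → Set
Split n c F = Σ (List ℤ) λ us → length us ≡ n × (∀ a → F a ≡ c * ∏lin us a)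

centred-split-degree : ∀ f {n} C → HasDegree f n → SplitsOverℤ f → Split n (coeff f n) (centred f C)
centred-split-degree f {n} C deg (c , xs , f≈) =
  map (_- C) xs , trans (length-map (_- C) xs) (sym (proj₁ degree)) ,
  λ a → trans (centred-split {f} {c} {xs} C f≈ a) (cong (_* ∏lin (map (_- C) xs) a) (proj₂ degree))
  where
  degree : n ≡ length xs × c ≡ coeff f n
  degree = split-degree {f} {n} {c} {xs} deg f≈

-- Even and odd split functions

∏sqDiff : List ℤ → ℤ → ℤ
∏sqDiff []       a = 1ℤ
∏sqDiff (e ∷ es) a = (a * a - e * e) * ∏sqDiff es a

∏sqDiffSlope : List ℤ → ℤ → ℤ
∏sqDiffSlope []       a = 0ℤ
∏sqDiffSlope (e ∷ es) a = (a * a - e * e) * ∏sqDiffSlope es a + + 2 * ∏sqDiff es a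

Derivative-square-sub : ∀ e → Derivative (λ a → a * a - e * e) (λ a → 1ℤ * a + a * 1ℤ + 0ℤ)
Derivative-square-sub e = Derivative-+ (Derivative-* Derivative-id Derivative-id) Derivative-const

∏sqDiff-derivative : ∀ es → Derivative (∏sqDiff es) (λ a → a * ∏sqDiffSlope es a)
∏sqDiff-derivative []       = Derivative-cong (λ _ → refl) (λ a → sym (ℤₚ.*-zeroʳ a)) Derivative-const
∏sqDiff-derivative (e ∷ es) =
  Derivative-cong (λ _ → refl) (λ a → regroup a e (∏sqDiff es a) (∏sqDiffSlope es a))
    (Derivative-* (Derivative-square-sub e) (∏sqDiff-derivative es))
  where
  regroup : ∀ a e P S → (1ℤ * a + a * 1ℤ + 0ℤ) * P + (a * a - e * e) * (a * S) ≡ a * ((a * a - e * e) * S + + 2 * P)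
  regroup = solve-∀

∏sqDiffSlope-differentiable : ∀ es → Differentiable (∏sqDiffSlope es)
∏sqDiffSlope-differentiable []       = _ , Derivative-const
∏sqDiffSlope-differentiable (e ∷ es) =
  _ , Derivative-+ (Derivative-* (Derivative-square-sub e) (proj₂ (∏sqDiffSlope-differentiable es)))
                   (Derivative-scale (+ 2) (∏sqDiff-derivative es))

∏lin-even⇒-u∈ : ∀ u rest → u ≢ 0ℤ → Even (∏lin (u ∷ rest)) → - u ∈ rest
∏lin-even⇒-u∈ u rest u≢0 even =
  ∏lin≡0⇒∈ rest (*≡0⇒≡0ʳ -u-u≢0 (trans (even u) (∈⇒∏lin≡0 {u} {u ∷ rest} (here refl))))
  where
  doubled : ∀ u → - u - u ≡ - + 2 * u
  doubled = solve-∀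
  -u-u≢0 : - u - u ≢ 0ℤ
  -u-u≢0 = *-≢0 { - + 2} (λ ()) u≢0 ∘ trans (sym (doubled u))

∏lin-pair-factor : ∀ u rest (-u∈rest : - u ∈ rest) a → ∏lin (u ∷ rest) a ≡ (a * a - u * u) * ∏lin (rest ─ -u∈rest) a
∏lin-pair-factor u rest -u∈rest a =
  trans (cong ((a - u) *_) (∏lin-─ -u∈rest a)) (difference-of-squares a u (∏lin (rest ─ -u∈rest) a))
  where
  difference-of-squares : ∀ a u q → (a - u) * ((a - - u) * q) ≡ (a * a - u * u) * q
  difference-of-squares = solve-∀

-- Evenness of Q := ∏lin (rest ─ -u∈rest) follows by cancelling a² − u² except at a = ±u;
-- those two points are covered by vanishes-off-two.
∏lin-even-peel : ∀ u rest (-u∈rest : - u ∈ rest) → Even (∏lin (u ∷ rest)) → Even (∏lin (rest ─ -u∈rest))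
∏lin-even-peel u rest -u∈rest even a = ℤₚ.i-j≡0⇒i≡j (Q (- a)) (Q a)
  (vanishes-off-two u (- u) (Derivative-+ (Derivative-reflect dQ) (Derivative-neg dQ)) Q-even-off-±u a)
  where
  Q : ℤ → ℤ
  Q = ∏lin (rest ─ -u∈rest)
  dQ : Derivative Q (proj₁ (∏lin-differentiable (rest ─ -u∈rest)))
  dQ = proj₂ (∏lin-differentiable (rest ─ -u∈rest))
  factor : ∀ a → ∏lin (u ∷ rest) a ≡ (a * a - u * u) * Q a
  factor = ∏lin-pair-factor u rest -u∈rest

  Q-even-off-±u : ∀ b → b ≢ u → b ≢ - u → Q (- b) - Q b ≡ 0ℤ
  Q-even-off-±u b b≢u b≢-u = trans (cong (_- Q b) Q-b≡Qb) (ℤₚ.+-inverseʳ (Q b))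
    where
    squares : ∀ b u → b * b - u * u ≡ (b - u) * (b - - u)
    squares = solve-∀
    reflect-square : ∀ b → - b * - b ≡ b * b
    reflect-square = solve-∀
    b²-u²≢0 : b * b - u * u ≢ 0ℤ
    b²-u²≢0 = *-≢0 (x≢y⇒x-y≢0 b≢u) (x≢y⇒x-y≢0 b≢-u) ∘ trans (sym (squares b u))
    Q-b≡Qb : Q (- b) ≡ Q b
    Q-b≡Qb = ℤₚ.*-cancelˡ-≡ (b * b - u * u) (Q (- b)) (Q b) {{ℤ.≢-nonZero b²-u²≢0}} (begin
      (b * b - u * u) * Q (- b)      ≡⟨ cong (λ x → (x - u * u) * Q (- b)) (reflect-square b) ⟨
      (- b * - b - u * u) * Q (- b)  ≡⟨ factor (- b) ⟨
      ∏lin (u ∷ rest) (- b)          ≡⟨ even b ⟩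
      ∏lin (u ∷ rest) b              ≡⟨ factor b ⟩
      (b * b - u * u) * Q b          ∎)
      where open ≡-Reasoning

PairedSplit : ℕ → ℤ → (ℤ → ℤ) → Set
PairedSplit n c F = Σ (List ℤ) λ es → 0ℤ ∉ es × n ≡ length es ℕ.+ length es × (∀ a → F a ≡ c * ∏sqDiff es a)

∏lin-even⇒paired : ∀ us → 0ℤ ∉ us → Even (∏lin us) → PairedSplit (length us) 1ℤ (∏lin us)
∏lin-even⇒paired us = bounded (length us) us ℕₚ.≤-refl
  where
  -- Peeling off the pair u, −u is not structural recursion on us, so recurse on a bound for its length.
  bounded : ∀ n us → length us ℕ.≤ n → 0ℤ ∉ us → Even (∏lin us) → PairedSplit (length us) 1ℤ (∏lin us)
  bounded _ [] _ _ _ = [] , (λ ()) , refl , λ _ → refl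
  bounded (suc n) (u ∷ rest) (s≤s |rest|≤n) 0∉ even =
    extend (bounded n rest′ |rest′|≤n (0∉ ∘ there ∘ ∈-─⁻ -u∈rest) (∏lin-even-peel u rest -u∈rest even))
    where
    u≢0 : u ≢ 0ℤ
    u≢0 u≡0 = 0∉ (here (sym u≡0))
    -u∈rest : - u ∈ rest
    -u∈rest = ∏lin-even⇒-u∈ u rest u≢0 even
    rest′ : List ℤ
    rest′ = rest ─ -u∈rest
    |rest|≡ : length rest ≡ suc (length rest′)
    |rest|≡ = length-removeAt′ rest (index -u∈rest)
    |rest′|≤n : length rest′ ℕ.≤ n
    |rest′|≤n = ℕₚ.<⇒≤ (subst (ℕ._≤ n) |rest|≡ |rest|≤n)
    extend : PairedSplit (length rest′) 1ℤ (∏lin rest′) → PairedSplit (length (u ∷ rest)) 1ℤ (∏lin (u ∷ rest))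
    extend (es , 0∉es , |rest′|≡ , Q≡) = u ∷ es , 0∉u∷es , |us|≡ , λ a → begin
      ∏lin (u ∷ rest) a                                ≡⟨ ∏lin-pair-factor u rest -u∈rest a ⟩
      (a * a - u * u) * ∏lin rest′ a                   ≡⟨ cong ((a * a - u * u) *_) (Q≡ a) ⟩
      (a * a - u * u) * (1ℤ * ∏sqDiff es a)            ≡⟨ rebracket (a * a - u * u) (∏sqDiff es a) ⟩
      1ℤ * ((a * a - u * u) * ∏sqDiff es a)            ∎
      where
      open ≡-Reasoning
      0∉u∷es : 0ℤ ∉ u ∷ es
      0∉u∷es (here 0≡u)   = 0∉ (here 0≡u)
      0∉u∷es (there 0∈es) = 0∉es 0∈es
      |us|≡ : suc (length rest) ≡ suc (length es) ℕ.+ suc (length es)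
      |us|≡ = cong suc (trans |rest|≡ (trans (cong suc |rest′|≡) (sym (ℕₚ.+-suc (length es) (length es)))))
      rebracket : ∀ x y → x * (1ℤ * y) ≡ 1ℤ * (x * y)
      rebracket = solve-∀

even-split⇒paired : ∀ {n c} → c ≢ 0ℤ → Split n c F → Even F → F 0ℤ ≢ 0ℤ → PairedSplit n c F
even-split⇒paired {F} {c = c} c≢0 (us , refl , F≡) even F0≢0 = rescale (∏lin-even⇒paired us 0∉us ∏lin-even)
  where
  0∉us : 0ℤ ∉ us
  0∉us 0∈us = F0≢0 (trans (F≡ 0ℤ) (trans (cong (c *_) (∈⇒∏lin≡0 0∈us)) (ℤₚ.*-zeroʳ c)))
  ∏lin-even : Even (∏lin us)
  ∏lin-even a = ℤₚ.*-cancelˡ-≡ c _ _ {{ℤ.≢-nonZero c≢0}} (trans (sym (F≡ (- a))) (trans (even a) (F≡ a)))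
  rescale : PairedSplit (length us) 1ℤ (∏lin us) → PairedSplit (length us) c F
  rescale (es , 0∉es , |us|≡ , ∏lin≡) =
    es , 0∉es , |us|≡ , λ a → trans (F≡ a) (cong (c *_) (trans (∏lin≡ a) (ℤₚ.*-identityˡ (∏sqDiff es a))))

OddPairedSplit : ℕ → ℤ → (ℤ → ℤ) → Set
OddPairedSplit n c F =
  Σ (List ℤ) λ es → 0ℤ ∉ es × n ≡ suc (length es ℕ.+ length es) × (∀ a → F a ≡ c * (a * ∏sqDiff es a))

-- F′(0) ≠ 0 makes 0 a simple root, and removing it leaves an even product.
odd-split⇒paired : ∀ {n c} → c ≢ 0ℤ → Split n c F → Odd F → Derivative F F′ → F′ 0ℤ ≢ 0ℤ → OddPairedSplit n c F
odd-split⇒paired {F} {F′} {c = c} c≢0 (us , refl , F≡) odd dF F′0≢0 = pair-up (∏lin-even⇒paired rest 0∉rest R-even)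
  where
  0∈us : 0ℤ ∈ us
  0∈us = ∏lin≡0⇒∈ us (*≡0⇒≡0ʳ c≢0 (trans (sym (F≡ 0ℤ)) (self-neg⇒≡0 (odd 0ℤ))))
  rest : List ℤ
  rest = us ─ 0∈us
  R : ℤ → ℤ
  R = ∏lin rest

  F≡c*x*R : ∀ a → F a ≡ c * (a * R a)
  F≡c*x*R a = trans (F≡ a) (cong (c *_) (trans (∏lin-─ 0∈us a) (cong (_* R a) (ℤₚ.+-identityʳ a))))

  0∉rest : 0ℤ ∉ rest
  0∉rest 0∈rest = F′0≢0 (begin
    F′ 0ℤ     ≡⟨ Derivative-x*-at-0 c (proj₂ (∏lin-differentiable rest)) F≡c*x*R dF ⟩
    c * R 0ℤ  ≡⟨ cong (c *_) (∈⇒∏lin≡0 0∈rest) ⟩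
    c * 0ℤ    ≡⟨ ℤₚ.*-zeroʳ c ⟩
    0ℤ        ∎)
    where open ≡-Reasoning

  R-even : Even R
  R-even a with a ℤ.≟ 0ℤ
  ... | yes refl = refl
  ... | no a≢0 = ℤₚ.*-cancelˡ-≡ (c * a) (R (- a)) (R a) {{ℤ.≢-nonZero (*-≢0 c≢0 a≢0)}} (begin
    c * a * R (- a)          ≡⟨ reflect c a (R (- a)) ⟩
    - (c * (- a * R (- a)))  ≡⟨ cong -_ (F≡c*x*R (- a)) ⟨
    - F (- a)                ≡⟨ cong -_ (odd a) ⟩
    - - F a                  ≡⟨ ℤₚ.neg-involutive (F a) ⟩
    F a                      ≡⟨ F≡c*x*R a ⟩
    c * (a * R a)            ≡⟨ ℤₚ.*-assoc c a (R a) ⟨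
    c * a * R a              ∎)
    where
    open ≡-Reasoning
    reflect : ∀ c a r → c * a * r ≡ - (c * (- a * r))
    reflect = solve-∀

  pair-up : PairedSplit (length rest) 1ℤ R → OddPairedSplit (length us) c F
  pair-up (es , 0∉es , |rest|≡ , R≡) =
    es , 0∉es , trans (length-removeAt′ us (index 0∈us)) (cong suc |rest|≡) ,
    λ a → trans (F≡c*x*R a) (cong (λ r → c * (a * r)) (trans (R≡ a) (ℤₚ.*-identityˡ (∏sqDiff es a))))

∏ℤ : List ℤ → ℤ
∏ℤ = foldr _*_ 1ℤ

∏ℤ-≢0 : ∀ es → 0ℤ ∉ es → ∏ℤ es ≢ 0ℤ
∏ℤ-≢0 []       _  = λ ()
∏ℤ-≢0 (e ∷ es) 0∉ = *-≢0 (λ e≡0 → 0∉ (here (sym e≡0))) (∏ℤ-≢0 es (0∉ ∘ there))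

-1^≢0 : ∀ n → -1ℤ ^ n ≢ 0ℤ
-1^≢0 zero    = λ ()
-1^≢0 (suc n) = *-≢0 { -1ℤ} (λ ()) (-1^≢0 n)

square-pos : ∀ {x} → x ≢ 0ℤ → ∃ λ n → x * x ≡ + suc n
square-pos {+ zero}   x≢0 = contradiction refl x≢0
square-pos {+ suc n}  _   = _ , sym (ℤₚ.pos-* (suc n) (suc n))
square-pos { -[1+ n ]} _  = _ , refl

∏sqDiff-at-0 : ∀ es → ∏sqDiff es 0ℤ ≡ -1ℤ ^ length es * (∏ℤ es * ∏ℤ es)
∏sqDiff-at-0 []       = refl
∏sqDiff-at-0 (e ∷ es) rewrite ∏sqDiff-at-0 es = regroup e (-1ℤ ^ length es) (∏ℤ es)
  where
  regroup : ∀ e s p → (0ℤ * 0ℤ - e * e) * (s * (p * p)) ≡ -1ℤ * s * (e * p * (e * p))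
  regroup = solve-∀

∏sqDiffSlope-step-at-0 : ∀ e es {E A B} → e * e ≡ + suc E → ∏ℤ es * ∏ℤ es ≡ + suc A →
  ∏sqDiffSlope es 0ℤ ≡ - (-1ℤ ^ length es * + B) →
  ∏sqDiffSlope (e ∷ es) 0ℤ ≡ - (-1ℤ ^ length (e ∷ es) * + (2 ℕ.* suc A ℕ.+ suc E ℕ.* B))
∏sqDiffSlope-step-at-0 e es {E} {A} {B} e²≡ ∏²≡ S≡ = begin
  (0ℤ * 0ℤ - e * e) * ∏sqDiffSlope es 0ℤ + + 2 * ∏sqDiff es 0ℤ
    ≡⟨ cong₂ (λ x y → (0ℤ * 0ℤ - x) * y + + 2 * ∏sqDiff es 0ℤ) e²≡ S≡ ⟩
  (0ℤ * 0ℤ - + suc E) * - (s * + B) + + 2 * ∏sqDiff es 0ℤ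
    ≡⟨ cong (λ y → (0ℤ * 0ℤ - + suc E) * - (s * + B) + + 2 * y) (trans (∏sqDiff-at-0 es) (cong (s *_) ∏²≡)) ⟩
  (0ℤ * 0ℤ - + suc E) * - (s * + B) + + 2 * (s * + suc A)
    ≡⟨ regroup (+ suc E) s (+ suc A) (+ B) ⟩
  - (-1ℤ * s * (+ 2 * + suc A + + suc E * + B))
    ≡⟨ cong (λ n → - (-1ℤ * s * n)) (cong₂ _+_ (ℤₚ.pos-* 2 (suc A)) (ℤₚ.pos-* (suc E) B)) ⟨
  - (-1ℤ * s * (+ (2 ℕ.* suc A) + + (suc E ℕ.* B)))
    ≡⟨ cong (λ n → - (-1ℤ * s * n)) (ℤₚ.pos-+ (2 ℕ.* suc A) (suc E ℕ.* B)) ⟨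
  - (-1ℤ * s * + (2 ℕ.* suc A ℕ.+ suc E ℕ.* B))
    ∎
  where
  open ≡-Reasoning
  s : ℤ
  s = -1ℤ ^ length es
  regroup : ∀ E s A B → (0ℤ * 0ℤ - E) * - (s * B) + + 2 * (s * A) ≡ - (-1ℤ * s * (+ 2 * A + E * B))
  regroup = solve-∀

∏sqDiffSlope-at-0 : ∀ es → 0ℤ ∉ es → ∃ λ B → ∏sqDiffSlope es 0ℤ ≡ - (-1ℤ ^ length es * + B)
∏sqDiffSlope-∷-at-0 : ∀ e es → 0ℤ ∉ e ∷ es → ∃ λ B → ∏sqDiffSlope (e ∷ es) 0ℤ ≡ - (-1ℤ ^ length (e ∷ es) * + suc B)

∏sqDiffSlope-at-0 []       _  = 0 , refl
∏sqDiffSlope-at-0 (e ∷ es) 0∉ = Σ-map suc id (∏sqDiffSlope-∷-at-0 e es 0∉)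

∏sqDiffSlope-∷-at-0 e es 0∉
  with square-pos (λ e≡0 → 0∉ (here (sym e≡0))) | square-pos (∏ℤ-≢0 es (0∉ ∘ there)) | ∏sqDiffSlope-at-0 es (0∉ ∘ there)
... | _ , e²≡ | _ , ∏²≡ | _ , S≡ = _ , ∏sqDiffSlope-step-at-0 e es e²≡ ∏²≡ S≡

∏sqDiffSlope-at-0-≢0 : ∀ e es → 0ℤ ∉ e ∷ es → ∏sqDiffSlope (e ∷ es) 0ℤ ≢ 0ℤ
∏sqDiffSlope-at-0-≢0 e es 0∉ =
  neg-≢0 (*-≢0 (-1^≢0 (length (e ∷ es))) (λ ())) ∘ trans (sym (proj₂ (∏sqDiffSlope-∷-at-0 e es 0∉)))

PairedSplit⇒F″[0]≢0 : ∀ {n c} → c ≢ 0ℤ → PairedSplit (suc n) c F → Derivative F F′ → Derivative F′ F″ → F″ 0ℤ ≢ 0ℤ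
PairedSplit⇒F″[0]≢0 c≢0 ([] , _ , () , _)
PairedSplit⇒F″[0]≢0 {F} {F′} {F″} {c = c} c≢0 (e ∷ es , 0∉ , _ , F≡) dF dF′ =
  *-≢0 c≢0 (∏sqDiffSlope-at-0-≢0 e es 0∉) ∘ trans (sym F″0≡)
  where
  F′≡ : ∀ a → F′ a ≡ c * (a * ∏sqDiffSlope (e ∷ es) a)
  F′≡ = Derivative-unique F≡ dF (Derivative-scale c (∏sqDiff-derivative (e ∷ es)))
  F″0≡ : F″ 0ℤ ≡ c * ∏sqDiffSlope (e ∷ es) 0ℤ
  F″0≡ = Derivative-x*-at-0 c (proj₂ (∏sqDiffSlope-differentiable (e ∷ es))) F′≡ dF′

even-nice⇒F″[C]≢0 : ∀ p {n} C → HasDegree p (suc n) → SplitsOverℤ p → Even (centred p C) → eval p C ≢ 0ℤ →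
  eval (deriv (deriv p)) C ≢ 0ℤ
even-nice⇒F″[C]≢0 p C deg p-splits even pC≢0 =
  PairedSplit⇒F″[0]≢0 (proj₁ deg)
    (even-split⇒paired (proj₁ deg) (centred-split-degree p C deg p-splits) even (pC≢0 ∘ trans (sym (centred-0 p C))))
    (centred-derivative p C) (centred-derivative (deriv p) C)
  ∘ trans (centred-0 (deriv (deriv p)) C)

-- Squares

IsSquare : ℕ → Set
IsSquare n = ∃ λ u → n ≡ u ℕ.* u

-- With g = gcd x y, the quotients x/g and y/g are coprime and x/g ∣ (y/g)², so x/g = 1.
*-square⇒square : ∀ n {x y} → x ≢ 0 → n ℕ.* (x ℕ.* x) ≡ y ℕ.* y → IsSquare n
*-square⇒square n {x} {y} x≢0 eq = y′ , n≡y′²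
  where
  g : ℕ
  g = gcd x y
  instance
    g≢0 : ℕ.NonZero g
    g≢0 = ℕ.≢-nonZero (gcd[m,n]≢0 x y (inj₁ x≢0))
    g²≢0 : ℕ.NonZero (g ℕ.* g)
    g²≢0 = ℕₚ.m*n≢0 g g
  x′ y′ : ℕ
  x′ = x / g
  y′ = y / g
  scale : ∀ n x g → n ℕ.* (x ℕ.* x) ℕ.* (g ℕ.* g) ≡ n ℕ.* ((x ℕ.* g) ℕ.* (x ℕ.* g))
  scale = ℕ-Solver.solve-∀
  rearrange : ∀ y g → (y ℕ.* g) ℕ.* (y ℕ.* g) ≡ y ℕ.* y ℕ.* (g ℕ.* g)
  rearrange = ℕ-Solver.solve-∀
  eq′ : n ℕ.* (x′ ℕ.* x′) ≡ y′ ℕ.* y′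
  eq′ = ℕₚ.*-cancelʳ-≡ _ _ (g ℕ.* g) (begin
    n ℕ.* (x′ ℕ.* x′) ℕ.* (g ℕ.* g)          ≡⟨ scale n x′ g ⟩
    n ℕ.* ((x′ ℕ.* g) ℕ.* (x′ ℕ.* g))        ≡⟨ cong (λ z → n ℕ.* (z ℕ.* z)) (m/n*n≡m (gcd[m,n]∣m x y)) ⟩
    n ℕ.* (x ℕ.* x)                          ≡⟨ eq ⟩
    y ℕ.* y                                  ≡⟨ cong (λ z → z ℕ.* z) (m/n*n≡m (gcd[m,n]∣n x y)) ⟨
    (y′ ℕ.* g) ℕ.* (y′ ℕ.* g)                ≡⟨ rearrange y′ g ⟩
    y′ ℕ.* y′ ℕ.* (g ℕ.* g)                  ∎)
    where open ≡-Reasoning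
  x′∣y′² : x′ ℕᵈ.∣ y′ ℕ.* y′
  x′∣y′² = ℕᵈ.divides (n ℕ.* x′) (trans (sym eq′) (sym (ℕₚ.*-assoc n x′ x′)))
  x′≡1 : x′ ≡ 1
  x′≡1 = coprime-/gcd x y (ℕᵈ.∣-refl , coprime-divisor (coprime-/gcd x y) x′∣y′²)
  n≡y′² : n ≡ y′ ℕ.* y′
  n≡y′² = trans (sym (ℕₚ.*-identityʳ n)) (trans (cong (λ z → n ℕ.* (z ℕ.* z)) (sym x′≡1)) eq′)

ℤ-*-square⇒square : ∀ n {x y} → x ≢ 0ℤ → + n * (x * x) ≡ y * y → IsSquare n
ℤ-*-square⇒square n {x} {y} x≢0 eq = *-square⇒square n {∣ x ∣} {∣ y ∣} (x≢0 ∘ ℤₚ.∣i∣≡0⇒i≡0) (begin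
  n ℕ.* (∣ x ∣ ℕ.* ∣ x ∣)   ≡⟨ cong (n ℕ.*_) (ℤₚ.abs-* x x) ⟨
  n ℕ.* ∣ x * x ∣           ≡⟨ ℤₚ.abs-* (+ n) (x * x) ⟨
  ∣ + n * (x * x) ∣         ≡⟨ cong ∣_∣ eq ⟩
  ∣ y * y ∣                 ≡⟨ ℤₚ.abs-* y y ⟩
  ∣ y ∣ ℕ.* ∣ y ∣           ∎)
  where open ≡-Reasoning

∏sqDiff-ratio-square : ∀ {c k bs es} → c ≢ 0ℤ → 0ℤ ∉ es → length bs ≡ length es →
  c * ∏sqDiff bs 0ℤ ≡ + k * c * ∏sqDiff es 0ℤ → IsSquare k
∏sqDiff-ratio-square {c} {k} {bs} {es} c≢0 0∉es |bs|≡|es| eq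
  rewrite ∏sqDiff-at-0 bs | ∏sqDiff-at-0 es | |bs|≡|es| =
  ℤ-*-square⇒square k {∏ℤ es} {∏ℤ bs} (∏ℤ-≢0 es 0∉es)
    (sym (ℤₚ.*-cancelˡ-≡ (c * s) (∏ℤ bs * ∏ℤ bs) (+ k * (∏ℤ es * ∏ℤ es)) {{ℤ.≢-nonZero c*s≢0}}
      (trans (ℤₚ.*-assoc c s (∏ℤ bs * ∏ℤ bs)) (trans eq (regroup (+ k) c s (∏ℤ es * ∏ℤ es))))))
  where
  s : ℤ
  s = -1ℤ ^ length es
  c*s≢0 : c * s ≢ 0ℤ
  c*s≢0 = *-≢0 c≢0 (-1^≢0 (length es))
  regroup : ∀ k c s E → k * c * (s * E) ≡ c * s * (k * E)
  regroup = solve-∀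

squares-≢2 : ∀ u → u ℕ.* u ≢ 2
squares-≢2 zero            ()
squares-≢2 (suc zero)      ()
squares-≢2 (suc (suc u)) u²≡2 = contradiction (subst (4 ℕ.≤_) u²≡2 (ℕₚ.*-mono-≤ 2≤u 2≤u)) λ { (s≤s (s≤s ())) }
  where
  2≤u : 2 ℕ.≤ suc (suc u)
  2≤u = s≤s (s≤s ℕ.z≤n)

¬squares-2-apart : ∀ {n} → IsSquare n → ¬ IsSquare (2 ℕ.+ n)
¬squares-2-apart (v , refl) (u , u²≡) with ℕₚ.≤-<-connex u v
... | inj₁ u≤v = ℕₚ.<-irrefl refl (begin-strict
  u ℕ.* u        ≤⟨ ℕₚ.*-mono-≤ u≤v u≤v ⟩
  v ℕ.* v        <⟨ ℕₚ.m<n+m (v ℕ.* v) (s≤s ℕ.z≤n) ⟩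
  2 ℕ.+ v ℕ.* v  ≡⟨ u²≡ ⟩
  u ℕ.* u        ∎)
  where open ℕₚ.≤-Reasoning
... | inj₂ v<u with v
...   | zero  = squares-≢2 u (sym u²≡)
...   | suc w = ℕₚ.m+1+n≰m (2 ℕ.+ suc w ℕ.* suc w) (begin
  (2 ℕ.+ suc w ℕ.* suc w) ℕ.+ suc (w ℕ.+ w)  ≡⟨ overshoot w ⟨
  suc (suc w) ℕ.* suc (suc w)                ≤⟨ ℕₚ.*-mono-≤ v<u v<u ⟩
  u ℕ.* u                                    ≡⟨ u²≡ ⟨
  2 ℕ.+ suc w ℕ.* suc w                      ∎)
  where
  open ℕₚ.≤-Reasoning
  overshoot : ∀ w → suc (suc w) ℕ.* suc (suc w) ≡ (2 ℕ.+ suc w ℕ.* suc w) ℕ.+ suc (w ℕ.+ w)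
  overshoot = ℕ-Solver.solve-∀

+-half-injective : ∀ {m n} → m ℕ.+ m ≡ n ℕ.+ n → m ≡ n
+-half-injective {m} {n} eq = trans (ℕₚ.n≡⌊n+n/2⌋ m) (trans (cong ℕ.⌊_/2⌋ eq) (sym (ℕₚ.n≡⌊n+n/2⌋ n)))

odd-split⇒square : ∀ {n c c′} → c ≢ 0ℤ → c′ ≡ + suc n * c → Split (suc n) c F → Split n c′ F′ →
  Derivative F F′ → Odd F → F′ 0ℤ ≢ 0ℤ → IsSquare (suc n) × PairedSplit n c′ F′
odd-split⇒square {F} {F′} {n} {c} {c′} c≢0 c′≡ F-split F′-split dF odd F′0≢0 =
  combine (odd-split⇒paired c≢0 F-split odd dF F′0≢0)
          (even-split⇒paired c′≢0 F′-split (Derivative-odd⇒even dF odd) F′0≢0)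
  where
  c′≢0 : c′ ≢ 0ℤ
  c′≢0 = *-≢0 {+ suc n} (λ ()) c≢0 ∘ trans (sym c′≡)
  combine : OddPairedSplit (suc n) c F → PairedSplit n c′ F′ → IsSquare (suc n) × PairedSplit n c′ F′
  combine (bs , _ , |bs|≡ , F≡) (es , 0∉es , |es|≡ , F′≡) =
    ∏sqDiff-ratio-square {bs = bs} c≢0 0∉es |bs|≡|es| F′0≡ , es , 0∉es , |es|≡ , F′≡
    where
    |bs|≡|es| : length bs ≡ length es
    |bs|≡|es| = +-half-injective (ℕₚ.suc-injective (trans (sym |bs|≡) (cong suc |es|≡)))
    F′0≡ : c * ∏sqDiff bs 0ℤ ≡ + suc n * c * ∏sqDiff es 0ℤ
    F′0≡ = trans (sym (Derivative-x*-at-0 c (∏sqDiff-derivative bs) F≡ dF))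
                 (trans (F′≡ 0ℤ) (cong (_* ∏sqDiff es 0ℤ) c′≡))

odd-nice⇒square : ∀ g {n} C → HasDegree g (suc n) → SplitsOverℤ g → SplitsOverℤ (deriv g) →
  Odd (centred g C) → eval (deriv g) C ≢ 0ℤ → IsSquare (suc n) × PairedSplit n (coeff (deriv g) n) (centred (deriv g) C)
odd-nice⇒square g {n} C deg g-splits g′-splits odd g′C≢0 =
  odd-split⇒square (proj₁ deg) (coeff-deriv g n)
    (centred-split-degree g C deg g-splits) (centred-split-degree (deriv g) C (HasDegree-deriv g deg) g′-splits)
    (centred-derivative g C) odd (g′C≢0 ∘ trans (sym (centred-0 (deriv g) C)))

no-odd-nice-chain : ∀ f {m} C → HasDegree f (3 ℕ.+ m) → SplitsOverℤ f → SplitsOverℤ (deriv f) →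
  SplitsOverℤ (deriv (deriv f)) → SplitsOverℤ (deriv (deriv (deriv f))) →
  Odd (centred f C) → eval (deriv f) C ≢ 0ℤ → ⊥
no-odd-nice-chain f {m} C deg s₀ s₁ s₂ s₃ odd f′C≢0 = ¬squares-2-apart (proj₁ f″-square) (proj₁ f-square)
  where
  f-square : IsSquare (3 ℕ.+ m) × PairedSplit (2 ℕ.+ m) (coeff (deriv f) (2 ℕ.+ m)) (centred (deriv f) C)
  f-square = odd-nice⇒square f C deg s₀ s₁ odd f′C≢0
  f‴C≢0 : eval (deriv (deriv (deriv f))) C ≢ 0ℤ
  f‴C≢0 = PairedSplit⇒F″[0]≢0 (proj₁ (HasDegree-deriv f deg)) (proj₂ f-square)
            (centred-derivative (deriv f) C) (centred-derivative (deriv (deriv f)) C)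
          ∘ trans (centred-0 (deriv (deriv (deriv f))) C)
  f″-odd : Odd (centred (deriv (deriv f)) C)
  f″-odd = Derivative-even⇒odd (centred-derivative (deriv f) C) (Derivative-odd⇒even (centred-derivative f C) odd)
  f″-square : IsSquare (1 ℕ.+ m) × PairedSplit m (coeff (deriv (deriv (deriv f))) m) (centred (deriv (deriv (deriv f))) C)
  f″-square = odd-nice⇒square (deriv (deriv f)) C (HasDegree-deriv (deriv f) (HasDegree-deriv f deg)) s₂ s₃ f″-odd f‴C≢0

simple-root⇒deriv : ∀ p q C → p ≈ₚ mulP (lin C) q → eval (deriv p) C ≡ eval q C
simple-root⇒deriv p q C p≈ = begin
  eval (deriv p) C        ≡⟨ centred-0 (deriv p) C ⟨
  centred (deriv p) C 0ℤ  ≡⟨ Derivative-x*-at-0 1ℤ (centred-derivative q C) p≡x*q (centred-derivative p C) ⟩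
  1ℤ * centred q C 0ℤ     ≡⟨ ℤₚ.*-identityˡ (centred q C 0ℤ) ⟩
  centred q C 0ℤ          ≡⟨ centred-0 q C ⟩
  eval q C                ∎
  where
  open ≡-Reasoning
  shift : ∀ C a Q → (C + a - C) * Q ≡ 1ℤ * (a * Q)
  shift = solve-∀
  p≡x*q : ∀ a → centred p C a ≡ 1ℤ * (a * centred q C a)
  p≡x*q a = begin
    eval p (C + a)                              ≡⟨ eval-≈ₚ p (mulP (lin C) q) p≈ (C + a) ⟩
    eval (mulP (lin C) q) (C + a)               ≡⟨ eval-mulP (lin C) q (C + a) ⟩
    eval (lin C) (C + a) * eval q (C + a)       ≡⟨ cong (_* eval q (C + a)) (eval-lin C (C + a)) ⟩
    (C + a - C) * eval q (C + a)                ≡⟨ shift C a (eval q (C + a)) ⟩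
    1ℤ * (a * eval q (C + a))                   ∎

corollary5p3 : ((p : Poly) (d : ℕ) (C : ℤ) → Nice p → HasDegree p d → 5 ≤ d →
    AntisymmetricWithCenter p C → SimpleRoot p C → ¬ Nice (deriv (deriv p)))
    ×
    ((p : Poly) (d : ℕ) (C : ℤ) → SymmetricWithCenter p C → HasDegree p d → 6 ≤ d →
    SplitsOverℤ p → eval p C ≢ + 0 → Nice (deriv p) →
    ¬ Nice (deriv (deriv (deriv p))))
corollary5p3 = antisymmetric , symmetric
  where
  antisymmetric : (p : Poly) (d : ℕ) (C : ℤ) → Nice p → HasDegree p d → 5 ≤ d →
    AntisymmetricWithCenter p C → SimpleRoot p C → ¬ Nice (deriv (deriv p))
  antisymmetric p (suc (suc (suc _))) C (_ , s₀ , s₁) deg (s≤s (s≤s (s≤s _))) (_ , odd) (q , p≈ , qC≢0) (_ , s₂ , s₃) =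
    no-odd-nice-chain p C deg s₀ s₁ s₂ s₃ odd (qC≢0 ∘ trans (sym (simple-root⇒deriv p q C p≈)))
  symmetric : (p : Poly) (d : ℕ) (C : ℤ) → SymmetricWithCenter p C → HasDegree p d → 6 ≤ d →
    SplitsOverℤ p → eval p C ≢ + 0 → Nice (deriv p) → ¬ Nice (deriv (deriv (deriv p)))
  symmetric p (suc (suc (suc (suc _)))) C (_ , even) deg (s≤s (s≤s (s≤s (s≤s _)))) s₀ pC≢0 (_ , s₁ , s₂) (_ , s₃ , s₄) =
    no-odd-nice-chain (deriv p) C (HasDegree-deriv p deg) s₁ s₂ s₃ s₄ (Derivative-even⇒odd (centred-derivative p C) even)
      (even-nice⇒F″[C]≢0 p C deg s₀ even pC≢0)
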